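{- For all $n\ge1$, $\lambda\in P(n)$ and $\beta\in C(n)$, $$|\mathrm{OBT}(\lambda,\beta)|=\sum_{\gamma\in S(\lambda,L(\beta))}m_{\lambda\setminus\gamma}(\lambda)\,|\mathrm{OBT}(\gamma,\beta^*)|.$$
   Context: $P(n)$, $C(n)$: partitions and compositions of $n$. For $\beta=(\beta_1,\dots,\beta_s)$ nonempty, $L(\beta)=\beta_s$ and $\beta^*=(\beta_1,\dots,\beta_{s-1})$. An ordered brick tabloid of shape $\lambda\in P(n)$ and content $\beta\in C(n)$ is a filling of the diagram of $\lambda$ (left-justified rows of boxes, row $i$ having $\lambda_i$ boxes) such that each label $i$ appears in exactly $\beta_i$ cells, all in the same row, and labels weakly increase left to right in each row; $\mathrm{OBT}(\lambda,\beta)$ is the set of these. For a partition $\lambda$ and $L>0$, $S(\lambda,L)$ is the set of partitions $\gamma$ obtained by replacing one part $i\ge L$ of $\lambda$ by $i-L$ (deleting it if it is $0$) and sorting the parts. Viewing partitions as multisets, for $\gamma\in S(\lambda,L)$ the multiset difference $\lambda\setminus\gamma$ consists of the single part $i$ that was replaced, and $m_{\lambda\setminus\gamma}(\lambda)$ denotes $m_i(\lambda)$, the number of parts of $\lambda$ equal to $i$. -}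

module Defs where

open import Data.Nat using (ℕ; zero; suc; _∸_; _<_; _≥_; _≤ᵇ_; _≡ᵇ_; _*_; _+_; _≟_; _≤?_)
open import Data.Nat.Properties using ()
open import Data.Bool using (Bool; true; false; _∧_; if_then_else_)
open import Data.List using (List; []; _∷_; [_]; length; map; concat; concatMap; filter; deduplicate; upTo; zip; foldr)
open import Data.Nat.ListAction using (sum)
open import Data.Bool.ListAction using (and)
open import Data.List.Properties using (≡-dec)
open import Data.List.Relation.Unary.All using (All)
open import Data.List.Relation.Unary.Linked using (Linked)
open import Data.Product using (_×_; _,_; proj₁; proj₂)
open import Relation.Nullary using (yes; no)
open import Relation.Binary.PropositionalEquality using (_≡_)

IsPartition : ℕ → List ℕ → Set
IsPartition n λ' = All (0 <_) λ' × Linked _≥_ λ' × sum λ' ≡ n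

IsComposition : ℕ → List ℕ → Set
IsComposition n β = All (0 <_) β × sum β ≡ n

-- L(β) = last part (0 for the empty list, never used since n ≥ 1)
lastPart : List ℕ → ℕ
lastPart []           = 0
lastPart (x ∷ [])     = x
lastPart (x ∷ y ∷ xs) = lastPart (y ∷ xs)

initParts : List ℕ → List ℕ
initParts []           = []
initParts (x ∷ [])     = []
initParts (x ∷ y ∷ xs) = x ∷ initParts (y ∷ xs)

labels : ℕ → List ℕ
labels s = map suc (upTo s)

rowsOf : ℕ → ℕ → List (List ℕ)
rowsOf zero    s = [ [] ]
rowsOf (suc k) s = concatMap (λ a → map (a ∷_) (rowsOf k s)) (labels s)

-- all fillings of the diagram of shape λ (row i has λ_i cells) by labels 1 … s
-- a filling is the list of its rows, each row read left to right
fillings : List ℕ → ℕ → List (List (List ℕ))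
fillings []        s = [ [] ]
fillings (l ∷ λ') s = concatMap (λ r → map (r ∷_) (fillings λ' s)) (rowsOf l s)

weaklyIncr : List ℕ → Bool
weaklyIncr []           = true
weaklyIncr (x ∷ [])     = true
weaklyIncr (x ∷ y ∷ xs) = (x ≤ᵇ y) ∧ weaklyIncr (y ∷ xs)

occ : ℕ → List ℕ → ℕ
occ a xs = length (filter (a ≟_) xs)

rowsContaining : ℕ → List (List ℕ) → ℕ
rowsContaining a F = length (filter (λ r → 0 <? occ a r) F)
  where open import Data.Nat using (_<?_)

labelOK : List (List ℕ) → ℕ × ℕ → Bool
labelOK F (a , b) = (occ a (concat F) ≡ᵇ b) ∧ (rowsContaining a F ≤ᵇ 1)

isOBT : List ℕ → List (List ℕ) → Bool
isOBT β F = and (map weaklyIncr F) ∧ and (map (labelOK F) (zip (labels (length β)) β))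

-- |OBT(λ, β)|: number of fillings of shape λ with labels in 1 … ℓ(β) that are OBTs.
-- (Every OBT of content β uses only labels 1 … ℓ(β), since the labels
--  1 … ℓ(β) already fill all |β| = |λ| cells.)
numOBT : List ℕ → List ℕ → ℕ
numOBT λ' β = length (filter (λ F → isOBT β F Data.Bool.≟ true) (fillings λ' (length β)))
  where import Data.Bool

insertDesc : ℕ → List ℕ → List ℕ
insertDesc a []       = [ a ]
insertDesc a (x ∷ xs) = if x ≤ᵇ a then a ∷ x ∷ xs else x ∷ insertDesc a xs

sortDesc : List ℕ → List ℕ
sortDesc = foldr insertDesc []

replacePart : ℕ → ℕ → List ℕ → List ℕ
replacePart L i rest with i ∸ L
... | zero  = sortDesc rest
... | suc k = sortDesc (suc k ∷ rest)

picks : List ℕ → List (ℕ × List ℕ)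
picks []        = []
picks (x ∷ xs) = (x , xs) ∷ map (λ p → proj₁ p , x ∷ proj₂ p) (picks xs)

S : List ℕ → ℕ → List (List ℕ)
S λ' L = deduplicate (≡-dec _≟_)
           (map (λ p → replacePart L (proj₁ p) (proj₂ p))
                (filter (λ p → L ≤? proj₁ p) (picks λ')))

removeOne : ℕ → List ℕ → List ℕ
removeOne a []       = []
removeOne a (x ∷ xs) with a ≟ x
... | yes _ = xs
... | no  _ = x ∷ removeOne a xs

_∖_ : List ℕ → List ℕ → List ℕ
λ' ∖ γ = foldr removeOne λ' γ

-- m_{λ∖γ}(λ): multiplicity in λ of the (single) part of λ ∖ γ
multDiff : List ℕ → List ℕ → ℕ
multDiff λ' γ with λ' ∖ γ
... | []    = 0
... | i ∷ _ = occ i λ'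

sumOver : List (List ℕ) → (List ℕ → ℕ) → ℕ
sumOver γs f = sum (map f γs)

{-# OPTIONS --safe #-}

-- In an ordered brick tabloid whose content β ends with the part L, the last label is
-- the largest one, so its L cells form the right end of a single row.  Erasing them
-- leaves an ordered brick tabloid of content β* on the shape in which that row is
-- shortened by L.  Hence |OBT(λ, β)| is the sum of |OBT(μ, β*)| over the shapes μ
-- obtained by shortening one row of length ≥ L, one term per row.  As |OBT(μ, β*)| is
-- invariant under permuting the rows and deleting an empty row, μ may be replaced by
-- its sorted form γ ∈ S(λ, L), and γ arises from exactly m_i(λ) rows: those of the
-- length i with λ ∖ γ = {i}.

module Submission where

open import Defs
open import Algebra.Bundles using (CommutativeMonoid)
open import Data.Bool as Bool using (Bool; true; false; _∧_; not; if_then_else_; T)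
open import Data.Bool.ListAction using (and)
open import Data.Bool.Properties using (∧-assoc; ∧-comm; ∧-zeroʳ; ∧-identityʳ; ∧-commutativeMonoid)
open import Data.Empty using (⊥-elim)
open import Data.List
  using (List; []; _∷_; [_]; _++_; _∷ʳ_; length; map; concat; concatMap; filter; upTo; zip; deduplicate)
open import Data.List.Properties
  using (∷-injectiveˡ; map-++; map-∘; map-cong; length-++; length-map; length-upTo; upTo-∷ʳ; filter-++; ≡-dec)
open import Data.List.Relation.Binary.Permutation.Propositional
  using (_↭_; ↭-sym) renaming (refl to ↭-refl; prep to ↭-prep; swap to ↭-swap; trans to ↭-trans)
open import Data.List.Relation.Binary.Permutation.Propositional.Properties using (↭-length; filter-↭; drop-∷)
open import Data.List.Relation.Unary.All as All using (All; []; _∷_)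
open import Data.List.Relation.Unary.All.Properties
  using (map⁺; applyUpTo⁺₁; ∷ʳ⁻; all-filter; filter⁺; deduplicate⁺)
open import Data.List.Reverse using (Reverse; []; _∶_∶ʳ_; reverseView)
open import Data.Nat
open import Data.Nat.ListAction using (sum)
open import Data.Nat.ListAction.Properties using (sum-++; sum-↭)
open import Data.Nat.Properties
open import Data.Product using (_×_; _,_; proj₁; proj₂)
open import Function using (_∘_)
open import Relation.Binary.Core using (_Preserves_⟶_)
open import Relation.Binary.Definitions using (DecidableEquality; tri<; tri≈; tri>)
open import Relation.Binary.PropositionalEquality hiding ([_])
open import Relation.Nullary using (does; yes; no; ¬?)
open import Relation.Nullary.Decidable using (dec-true; dec-false)
open import Relation.Unary using (Decidable)

open import Algebra.Properties.CommutativeSemigroup +-commutativeSemigroup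
  using () renaming (interchange to +-interchange; x∙yz≈y∙xz to +-left-commute)
open import Algebra.Properties.CommutativeSemigroup (CommutativeMonoid.commutativeSemigroup ∧-commutativeMonoid)
  using () renaming (interchange to ∧-interchange)

-- Finite sums

private variable
  A B : Set

𝟙 : Bool → ℕ
𝟙 true  = 1
𝟙 false = 0

𝟙-∧ : ∀ a b → 𝟙 (a ∧ b) ≡ 𝟙 a * 𝟙 b
𝟙-∧ true  b = sym (*-identityˡ (𝟙 b))
𝟙-∧ false b = refl

𝟙-∧-* : ∀ a b n → 𝟙 (a ∧ b) * n ≡ 𝟙 a * (𝟙 b * n)
𝟙-∧-* a b n = trans (cong (_* n) (𝟙-∧ a b)) (*-assoc (𝟙 a) (𝟙 b) n)

∑ : List A → (A → ℕ) → ℕ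
∑ xs f = sum (map f xs)

∑-++ : ∀ (xs ys : List A) f → ∑ (xs ++ ys) f ≡ ∑ xs f + ∑ ys f
∑-++ xs ys f = trans (cong sum (map-++ f xs ys)) (sum-++ (map f xs) (map f ys))

∑-map : ∀ (g : A → B) xs f → ∑ (map g xs) f ≡ ∑ xs (f ∘ g)
∑-map g xs f = cong sum (sym (map-∘ xs))

∑-concatMap : ∀ (g : A → List B) xs f → ∑ (concatMap g xs) f ≡ ∑ xs (λ x → ∑ (g x) f)
∑-concatMap g []       f = refl
∑-concatMap g (x ∷ xs) f =
  trans (∑-++ (g x) (concatMap g xs) f) (cong (∑ (g x) f +_) (∑-concatMap g xs f))

∑-cong : ∀ (xs : List A) {f g} → (∀ x → f x ≡ g x) → ∑ xs f ≡ ∑ xs g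
∑-cong xs f≗g = cong sum (map-cong f≗g xs)

∑-cong-All : ∀ {xs : List A} {f g} → All (λ x → f x ≡ g x) xs → ∑ xs f ≡ ∑ xs g
∑-cong-All []           = refl
∑-cong-All (fx≡gx ∷ eq) = cong₂ _+_ fx≡gx (∑-cong-All eq)

∑-0 : ∀ (xs : List A) → ∑ xs (λ _ → 0) ≡ 0
∑-0 []       = refl
∑-0 (x ∷ xs) = ∑-0 xs

∑-≡0 : ∀ (xs : List A) {f} → (∀ x → f x ≡ 0) → ∑ xs f ≡ 0
∑-≡0 xs f≡0 = trans (∑-cong xs f≡0) (∑-0 xs)

*-≡0 : ∀ m {n} → n ≡ 0 → m * n ≡ 0
*-≡0 m n≡0 = trans (cong (m *_) n≡0) (*-zeroʳ m)

∑-distrib-+ : ∀ (xs : List A) f g → ∑ xs (λ x → f x + g x) ≡ ∑ xs f + ∑ xs g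
∑-distrib-+ []       f g = refl
∑-distrib-+ (x ∷ xs) f g =
  trans (cong (f x + g x +_) (∑-distrib-+ xs f g)) (+-interchange (f x) (g x) (∑ xs f) (∑ xs g))

∑-*ˡ : ∀ (xs : List A) c f → ∑ xs (λ x → c * f x) ≡ c * ∑ xs f
∑-*ˡ []       c f = sym (*-zeroʳ c)
∑-*ˡ (x ∷ xs) c f = trans (cong (c * f x +_) (∑-*ˡ xs c f)) (sym (*-distribˡ-+ c (f x) (∑ xs f)))

∑-*ʳ : ∀ (xs : List A) f c → ∑ xs (λ x → f x * c) ≡ ∑ xs f * c
∑-*ʳ xs f c = trans (∑-cong xs (λ x → *-comm (f x) c)) (trans (∑-*ˡ xs c f) (*-comm c (∑ xs f)))

∑-*ˡ-* : ∀ (xs : List A) c (f g : A → ℕ) →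
  ∑ xs (λ x → c * f x * g x) ≡ c * ∑ xs (λ x → f x * g x)
∑-*ˡ-* xs c f g = trans (∑-cong xs (λ x → *-assoc c (f x) (g x))) (∑-*ˡ xs c (λ x → f x * g x))

∑-comm : ∀ (xs : List A) (ys : List B) (f : A → B → ℕ) →
  ∑ xs (λ x → ∑ ys (f x)) ≡ ∑ ys (λ y → ∑ xs (λ x → f x y))
∑-comm []       ys f = sym (∑-0 ys)
∑-comm (x ∷ xs) ys f =
  trans (cong (∑ ys (f x) +_) (∑-comm xs ys f))
        (sym (∑-distrib-+ ys (f x) (λ y → ∑ xs (λ x → f x y))))

module _ {P : A → Set} (P? : Decidable P) where

  ∑-filter : ∀ xs h → ∑ (filter P? xs) h ≡ ∑ xs (λ x → 𝟙 (does (P? x)) * h x)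
  ∑-filter []       h = refl
  ∑-filter (x ∷ xs) h with does (P? x)
  ... | true  = cong₂ _+_ (sym (+-identityʳ (h x))) (∑-filter xs h)
  ... | false = ∑-filter xs h

  length-filter-∑ : ∀ xs → length (filter P? xs) ≡ ∑ xs (λ x → 𝟙 (does (P? x)))
  length-filter-∑ []       = refl
  length-filter-∑ (x ∷ xs) with does (P? x)
  ... | true  = cong suc (length-filter-∑ xs)
  ... | false = length-filter-∑ xs

≡ᵇ-refl : ∀ a → (a ≡ᵇ a) ≡ true
≡ᵇ-refl a = dec-true (a ≟ a) refl

≢⇒≡ᵇ≡false : ∀ {a b} → a ≢ b → (a ≡ᵇ b) ≡ false
≢⇒≡ᵇ≡false {a} {b} = dec-false (a ≟ b)

≤⇒≤ᵇ≡true : ∀ {a b} → a ≤ b → (a ≤ᵇ b) ≡ true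
≤⇒≤ᵇ≡true {a} {b} = dec-true (a ≤? b)

<⇒≤ᵇ≡false : ∀ {a b} → b < a → (a ≤ᵇ b) ≡ false
<⇒≤ᵇ≡false {a} {b} b<a = dec-false (a ≤? b) (<⇒≱ b<a)

≤ᵇ≡true⇒≤ : ∀ a b → (a ≤ᵇ b) ≡ true → a ≤ b
≤ᵇ≡true⇒≤ a b eq = ≤ᵇ⇒≤ a b (subst T (sym eq) _)

≤ᵇ≡false⇒> : ∀ a b → (a ≤ᵇ b) ≡ false → b < a
≤ᵇ≡false⇒> a b eq = ≰⇒> (λ a≤b → subst T eq (≤⇒≤ᵇ a≤b))

+-≡ᵇ-0 : ∀ m n → (m + n ≡ᵇ 0) ≡ (m ≡ᵇ 0) ∧ (n ≡ᵇ 0)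
+-≡ᵇ-0 zero    n = refl
+-≡ᵇ-0 (suc m) n = refl

occ-∷ : ∀ c x xs → occ c (x ∷ xs) ≡ 𝟙 (c ≡ᵇ x) + occ c xs
occ-∷ c x xs with c ≡ᵇ x
... | true  = refl
... | false = refl

occ-∷-≢ : ∀ {c x} xs → c ≢ x → occ c (x ∷ xs) ≡ occ c xs
occ-∷-≢ {c} {x} xs c≢x = trans (occ-∷ c x xs) (cong (λ b → 𝟙 b + occ c xs) (≢⇒≡ᵇ≡false c≢x))

occ-∷-≡ : ∀ c xs → occ c (c ∷ xs) ≡ suc (occ c xs)
occ-∷-≡ c xs = trans (occ-∷ c c xs) (cong (λ b → 𝟙 b + occ c xs) (≡ᵇ-refl c))

occ-++ : ∀ a xs ys → occ a (xs ++ ys) ≡ occ a xs + occ a ys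
occ-++ a xs ys = trans (cong length (filter-++ (a ≟_) xs ys)) (length-++ (filter (a ≟_) xs))

occ-↭ : ∀ c {xs ys} → xs ↭ ys → occ c xs ≡ occ c ys
occ-↭ c p = ↭-length (filter-↭ (c ≟_) p)

removeAll : ℕ → List ℕ → List ℕ
removeAll s = filter (λ a → ¬? (a ≟ s))

removeAll-∷-≢ : ∀ {s a} r → a ≢ s → removeAll s (a ∷ r) ≡ a ∷ removeAll s r
removeAll-∷-≢ {s} {a} r a≢s rewrite ≢⇒≡ᵇ≡false a≢s = refl

removeAll-∷-≡ : ∀ s r → removeAll s (s ∷ r) ≡ removeAll s r
removeAll-∷-≡ s r rewrite ≡ᵇ-refl s = refl

occ-removeAll : ∀ {a s} r → a ≢ s → occ a (removeAll s r) ≡ occ a r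
occ-removeAll         []      a≢s = refl
occ-removeAll {a} {s} (x ∷ r) a≢s with x ≟ s
... | yes refl =
  trans (cong (occ a) (removeAll-∷-≡ s r)) (trans (occ-removeAll r a≢s) (sym (occ-∷-≢ r a≢s)))
... | no  x≢s  = begin
  occ a (removeAll s (x ∷ r))    ≡⟨ cong (occ a) (removeAll-∷-≢ r x≢s) ⟩
  occ a (x ∷ removeAll s r)      ≡⟨ occ-∷ a x (removeAll s r) ⟩
  𝟙 (a ≡ᵇ x) + occ a (removeAll s r) ≡⟨ cong (𝟙 (a ≡ᵇ x) +_) (occ-removeAll r a≢s) ⟩
  𝟙 (a ≡ᵇ x) + occ a r           ≡⟨ occ-∷ a x r ⟨
  occ a (x ∷ r)                  ∎
  where open ≡-Reasoning

labels-∷ʳ : ∀ n → labels (suc n) ≡ labels n ∷ʳ suc n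
labels-∷ʳ n = trans (cong (map suc) (sym (upTo-∷ʳ n))) (map-++ suc (upTo n) [ n ])

labels-≤ : ∀ n → All (_≤ n) (labels n)
labels-≤ n = map⁺ (applyUpTo⁺₁ (λ i → i) n (λ i<n → i<n))

length-labels : ∀ n → length (labels n) ≡ n
length-labels n = trans (length-map suc (upTo n)) (length-upTo n)

incrFrom : ℕ → List ℕ → Bool
incrFrom b []      = true
incrFrom b (a ∷ r) = (b ≤ᵇ a) ∧ incrFrom a r

weaklyIncr≡incrFrom-0 : ∀ r → weaklyIncr r ≡ incrFrom 0 r
weaklyIncr≡incrFrom-0 []      = refl
weaklyIncr≡incrFrom-0 (a ∷ r) = weaklyIncr-∷ a r
  where
  weaklyIncr-∷ : ∀ a r → weaklyIncr (a ∷ r) ≡ incrFrom a r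
  weaklyIncr-∷ a []      = refl
  weaklyIncr-∷ a (x ∷ r) = cong ((a ≤ᵇ x) ∧_) (weaklyIncr-∷ x r)

∑-rowsOf-suc : ∀ m u f →
  ∑ (rowsOf (suc m) u) f ≡ ∑ (labels u) (λ a → ∑ (rowsOf m u) (f ∘ (a ∷_)))
∑-rowsOf-suc m u f =
  trans (∑-concatMap _ (labels u) f) (∑-cong (labels u) (λ a → ∑-map (a ∷_) (rowsOf m u) f))

incrRows : (u l b : ℕ) → (List ℕ → ℕ) → ℕ
incrRows u l b h = ∑ (rowsOf l u) (λ r → 𝟙 (incrFrom b r) * h r)

incrRows-suc : ∀ u m b h →
  incrRows u (suc m) b h ≡ ∑ (labels u) (λ a → 𝟙 (b ≤ᵇ a) * incrRows u m a (h ∘ (a ∷_)))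
incrRows-suc u m b h = trans (∑-rowsOf-suc m u _) (∑-cong (labels u) λ a →
  trans (∑-cong (rowsOf m u) (λ r → 𝟙-∧-* (b ≤ᵇ a) (incrFrom a r) (h (a ∷ r))))
        (∑-*ˡ (rowsOf m u) (𝟙 (b ≤ᵇ a)) _))

incrRows-above : ∀ u m b h → u < b → incrRows u (suc m) b h ≡ 0
incrRows-above u m b h u<b = trans (incrRows-suc u m b h) (trans
  (∑-cong-All (All.map (λ a≤u → cong (λ z → 𝟙 z * _) (<⇒≤ᵇ≡false (≤-<-trans a≤u u<b))) (labels-≤ u)))
  (∑-0 (labels u)))

allRowsIncr : List (List ℕ) → Bool
allRowsIncr F = and (map weaklyIncr F)

rowsContaining-∷ : ∀ a r F → rowsContaining a (r ∷ F) ≡ 𝟙 (0 <ᵇ occ a r) + rowsContaining a F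
rowsContaining-∷ a r F with occ a r
... | zero  = refl
... | suc _ = refl

-- This is the form in which rowsContaining a (r ∷ F) ≤ᵇ 1 reduces when a occurs in r.
rowsContaining-<ᵇ1 : ∀ a F → (rowsContaining a F <ᵇ 1) ≡ (occ a (concat F) ≡ᵇ 0)
rowsContaining-<ᵇ1 a []      = refl
rowsContaining-<ᵇ1 a (r ∷ F) rewrite rowsContaining-∷ a r F | occ-++ a r (concat F) with occ a r
... | zero  = rowsContaining-<ᵇ1 a F
... | suc _ = refl

labelOK-∷-absent : ∀ {a} r F b → occ a r ≡ 0 → labelOK (r ∷ F) (a , b) ≡ labelOK F (a , b)
labelOK-∷-absent {a} r F b o≡0 rewrite occ-++ a r (concat F) | rowsContaining-∷ a r F | o≡0 = refl

labelOK-∷-present : ∀ {a o} r F b → occ a r ≡ suc o →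
  labelOK (r ∷ F) (a , b) ≡ (suc o ≡ᵇ b) ∧ (occ a (concat F) ≡ᵇ 0)
labelOK-∷-present {a} {o} r F b o≡1+ rewrite occ-++ a r (concat F) | rowsContaining-∷ a r F | o≡1+
  | rowsContaining-<ᵇ1 a F with occ a (concat F)
... | zero  = cong (λ n → (n ≡ᵇ b) ∧ true) (+-identityʳ (suc o))
... | suc _ = trans (∧-zeroʳ _) (sym (∧-zeroʳ _))

occ-concat-removeAll : ∀ {a s} F → a ≢ s → occ a (concat (map (removeAll s) F)) ≡ occ a (concat F)
occ-concat-removeAll         []      a≢s = refl
occ-concat-removeAll {a} {s} (r ∷ F) a≢s
  rewrite occ-++ a (removeAll s r) (concat (map (removeAll s) F)) | occ-++ a r (concat F)
  = cong₂ _+_ (occ-removeAll r a≢s) (occ-concat-removeAll F a≢s)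

rowsContaining-removeAll : ∀ {a s} F → a ≢ s →
  rowsContaining a (map (removeAll s) F) ≡ rowsContaining a F
rowsContaining-removeAll         []      a≢s = refl
rowsContaining-removeAll {a} {s} (r ∷ F) a≢s
  rewrite rowsContaining-∷ a (removeAll s r) (map (removeAll s) F) | rowsContaining-∷ a r F
        | occ-removeAll r a≢s
  = cong (𝟙 (0 <ᵇ occ a r) +_) (rowsContaining-removeAll F a≢s)

labelOK-removeAll : ∀ {a s} F b → a ≢ s → labelOK (map (removeAll s) F) (a , b) ≡ labelOK F (a , b)
labelOK-removeAll F b a≢s rewrite occ-concat-removeAll F a≢s | rowsContaining-removeAll F a≢s = refl

labelsOK : List ℕ → List (List ℕ) → Bool
labelsOK β F = and (map (labelOK F) (zip (labels (length β)) β))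

labelsOK-removeAll : ∀ {s} β F → length β < s → labelsOK β (map (removeAll s) F) ≡ labelsOK β F
labelsOK-removeAll {s} β F n<s =
  go (All.map (λ a≤n → <⇒≢ (≤-<-trans a≤n n<s)) (labels-≤ (length β))) β
  where
  go : ∀ {ls} → All (_≢ s) ls → ∀ β →
    and (map (labelOK (map (removeAll s) F)) (zip ls β)) ≡ and (map (labelOK F) (zip ls β))
  go []          β       = refl
  go (_ ∷ _)     []      = refl
  go (a≢s ∷ ps) (b ∷ β) = cong₂ _∧_ (labelOK-removeAll F b a≢s) (go ps β)

length-∷ʳ : ∀ (xs : List A) x → length (xs ∷ʳ x) ≡ suc (length xs)
length-∷ʳ xs x = trans (length-++ xs) (+-comm (length xs) 1)

zip-∷ʳ : ∀ (xs : List A) (ys : List B) x y → length xs ≡ length ys →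
  zip (xs ∷ʳ x) (ys ∷ʳ y) ≡ zip xs ys ∷ʳ (x , y)
zip-∷ʳ []       []       x y _   = refl
zip-∷ʳ (a ∷ xs) (b ∷ ys) x y len = cong ((a , b) ∷_) (zip-∷ʳ xs ys x y (suc-injective len))

and-++ : ∀ xs ys → and (xs ++ ys) ≡ and xs ∧ and ys
and-++ []       ys = refl
and-++ (x ∷ xs) ys = trans (cong (x ∧_) (and-++ xs ys)) (sym (∧-assoc x (and xs) (and ys)))

isOBT-∷ʳ : ∀ β L F →
  isOBT (β ∷ʳ L) F ≡ allRowsIncr F ∧ (labelsOK β F ∧ labelOK F (suc (length β) , L))
isOBT-∷ʳ β L F = cong (allRowsIncr F ∧_) (begin
  and (map (labelOK F) (zip (labels (length (β ∷ʳ L))) (β ∷ʳ L)))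
    ≡⟨ cong (λ n → and (map (labelOK F) (zip (labels n) (β ∷ʳ L)))) (length-∷ʳ β L) ⟩
  and (map (labelOK F) (zip (labels (suc (length β))) (β ∷ʳ L)))
    ≡⟨ cong (λ ls → and (map (labelOK F) (zip ls (β ∷ʳ L)))) (labels-∷ʳ (length β)) ⟩
  and (map (labelOK F) (zip (labels (length β) ∷ʳ suc (length β)) (β ∷ʳ L)))
    ≡⟨ cong (and ∘ map (labelOK F)) (zip-∷ʳ (labels (length β)) β _ L (length-labels (length β))) ⟩
  and (map (labelOK F) (zip (labels (length β)) β ∷ʳ (suc (length β) , L)))
    ≡⟨ cong and (map-++ (labelOK F) (zip (labels (length β)) β) _) ⟩
  and (map (labelOK F) (zip (labels (length β)) β) ∷ʳ labelOK F (suc (length β) , L))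
    ≡⟨ and-++ (map (labelOK F) (zip (labels (length β)) β)) _ ⟩
  labelsOK β F ∧ (labelOK F (suc (length β) , L) ∧ true)
    ≡⟨ cong (labelsOK β F ∧_) (∧-identityʳ _) ⟩
  labelsOK β F ∧ labelOK F (suc (length β) , L) ∎)
  where open ≡-Reasoning

-- Counting fillings row by row

incrFillings : ℕ → List ℕ → (List (List ℕ) → ℕ) → ℕ
incrFillings u ν Ψ = ∑ (fillings ν u) (λ F → 𝟙 (allRowsIncr F) * Ψ F)

∑-fillings-∷ : ∀ l ν u f →
  ∑ (fillings (l ∷ ν) u) f ≡ ∑ (rowsOf l u) (λ r → ∑ (fillings ν u) (f ∘ (r ∷_)))
∑-fillings-∷ l ν u f =
  trans (∑-concatMap _ (rowsOf l u) f) (∑-cong (rowsOf l u) (λ r → ∑-map (r ∷_) (fillings ν u) f))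

incrFillings-∷ : ∀ u l ν Ψ →
  incrFillings u (l ∷ ν) Ψ ≡ ∑ (rowsOf l u) (λ r → 𝟙 (weaklyIncr r) * incrFillings u ν (Ψ ∘ (r ∷_)))
incrFillings-∷ u l ν Ψ = trans (∑-fillings-∷ l ν u _) (∑-cong (rowsOf l u) λ r →
  trans (∑-cong (fillings ν u) (λ F → 𝟙-∧-* (weaklyIncr r) (allRowsIncr F) (Ψ (r ∷ F))))
        (∑-*ˡ (fillings ν u) (𝟙 (weaklyIncr r)) _))

numOBT≡∑ : ∀ ν β → numOBT ν β ≡ ∑ (fillings ν (length β)) (λ F → 𝟙 (isOBT β F))
numOBT≡∑ ν β = trans (length-filter-∑ (λ F → isOBT β F Bool.≟ true) (fillings ν (length β)))
                     (∑-cong (fillings ν (length β)) (λ F → cong 𝟙 (does-≟-true (isOBT β F))))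
  where
  does-≟-true : ∀ b → does (b Bool.≟ true) ≡ b
  does-≟-true true  = refl
  does-≟-true false = refl

numOBT≡incrFillings : ∀ ν β → numOBT ν β ≡ incrFillings (length β) ν (𝟙 ∘ labelsOK β)
numOBT≡incrFillings ν β = trans (numOBT≡∑ ν β)
  (∑-cong (fillings ν (length β)) (λ F → 𝟙-∧ (allRowsIncr F) (labelsOK β F)))

-- S(λ, L) with repetitions, before sorting and deleting the empty row.
removeBrick : ℕ → List ℕ → List (List ℕ)
removeBrick L []      = []
removeBrick L (x ∷ ν) = (if L ≤ᵇ x then [ (x ∸ L) ∷ ν ] else []) ++ map (x ∷_) (removeBrick L ν)

∑-removeBrick-∷ : ∀ L x ν g →
  ∑ (removeBrick L (x ∷ ν)) g ≡ 𝟙 (L ≤ᵇ x) * g ((x ∸ L) ∷ ν) + ∑ (removeBrick L ν) (g ∘ (x ∷_))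
∑-removeBrick-∷ L x ν g with L ≤ᵇ x
... | true  = cong₂ _+_ (sym (+-identityʳ _)) (∑-map (x ∷_) (removeBrick L ν) g)
... | false = ∑-map (x ∷_) (removeBrick L ν) g

-- Erasing the top label

module TopLabel (t : ℕ) where

  top : ℕ
  top = suc t

  incrRowsTop : (l k b : ℕ) → (List ℕ → ℕ) → ℕ
  incrRowsTop l k b h =
    ∑ (rowsOf l top) (λ r → 𝟙 (incrFrom b r ∧ (occ top r ≡ᵇ k)) * h (removeAll top r))

  startingWithTop : (m k : ℕ) → (List ℕ → ℕ) → ℕ
  startingWithTop m zero    h = 0
  startingWithTop m (suc k) h = incrRowsTop m k top h

  incrRowsTop-suc : ∀ m k b h → incrRowsTop (suc m) k b h ≡
    ∑ (labels t) (λ a → 𝟙 (b ≤ᵇ a) * incrRowsTop m k a (h ∘ (a ∷_)))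
      + 𝟙 (b ≤ᵇ top) * startingWithTop m k h
  incrRowsTop-suc m k b h = begin
    incrRowsTop (suc m) k b h
      ≡⟨ ∑-rowsOf-suc m top _ ⟩
    ∑ (labels top) (λ a → ∑ (rowsOf m top) (term k a))
      ≡⟨ cong (λ ls → ∑ ls (λ a → ∑ (rowsOf m top) (term k a))) (labels-∷ʳ t) ⟩
    ∑ (labels t ∷ʳ top) (λ a → ∑ (rowsOf m top) (term k a))
      ≡⟨ ∑-++ (labels t) [ top ] _ ⟩
    ∑ (labels t) (λ a → ∑ (rowsOf m top) (term k a)) + (∑ (rowsOf m top) (term k top) + 0)
      ≡⟨ cong₂ _+_ (∑-cong-All (All.map below (labels-≤ t))) (trans (+-identityʳ _) (atTop k)) ⟩
    ∑ (labels t) (λ a → 𝟙 (b ≤ᵇ a) * incrRowsTop m k a (h ∘ (a ∷_)))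
      + 𝟙 (b ≤ᵇ top) * startingWithTop m k h ∎
    where
    open ≡-Reasoning
    term : ℕ → ℕ → List ℕ → ℕ
    term k a r = 𝟙 (incrFrom b (a ∷ r) ∧ (occ top (a ∷ r) ≡ᵇ k)) * h (removeAll top (a ∷ r))

    below : ∀ {a} → a ≤ t →
      ∑ (rowsOf m top) (term k a) ≡ 𝟙 (b ≤ᵇ a) * incrRowsTop m k a (h ∘ (a ∷_))
    below {a} a≤t = trans (∑-cong (rowsOf m top) term≡) (∑-*ˡ (rowsOf m top) (𝟙 (b ≤ᵇ a)) _)
      where
      a≢top : a ≢ top
      a≢top = <⇒≢ (s≤s a≤t)
      term≡ : ∀ r →
        term k a r ≡ 𝟙 (b ≤ᵇ a) * (𝟙 (incrFrom a r ∧ (occ top r ≡ᵇ k)) * h (a ∷ removeAll top r))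
      term≡ r rewrite occ-∷-≢ r (≢-sym a≢top) | removeAll-∷-≢ r a≢top
                    | ∧-assoc (b ≤ᵇ a) (incrFrom a r) (occ top r ≡ᵇ k) = 𝟙-∧-* (b ≤ᵇ a) _ _

    atTop : ∀ k → ∑ (rowsOf m top) (term k top) ≡ 𝟙 (b ≤ᵇ top) * startingWithTop m k h
    atTop zero    = trans (∑-≡0 (rowsOf m top) term≡0) (sym (*-zeroʳ (𝟙 (b ≤ᵇ top))))
      where
      term≡0 : ∀ r → term 0 top r ≡ 0
      term≡0 r rewrite occ-∷-≡ top r | ∧-zeroʳ ((b ≤ᵇ top) ∧ incrFrom top r) = refl
    atTop (suc k) = trans (∑-cong (rowsOf m top) term≡) (∑-*ˡ (rowsOf m top) (𝟙 (b ≤ᵇ top)) _)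
      where
      term≡ : ∀ r →
        term (suc k) top r ≡ 𝟙 (b ≤ᵇ top) * (𝟙 (incrFrom top r ∧ (occ top r ≡ᵇ k)) * h (removeAll top r))
      term≡ r rewrite occ-∷-≡ top r | removeAll-∷-≡ top r
                    | ∧-assoc (b ≤ᵇ top) (incrFrom top r) (occ top r ≡ᵇ k) = 𝟙-∧-* (b ≤ᵇ top) _ _

  incrRowsTop-short : ∀ l k b h → l < k → incrRowsTop l k b h ≡ 0
  incrRowsTop-short zero    (suc k) b h _         = refl
  incrRowsTop-short (suc m) (suc k) b h (s≤s m<k) = begin
    incrRowsTop (suc m) (suc k) b h
      ≡⟨ incrRowsTop-suc m (suc k) b h ⟩
    ∑ (labels t) (λ a → 𝟙 (b ≤ᵇ a) * incrRowsTop m (suc k) a (h ∘ (a ∷_)))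
      + 𝟙 (b ≤ᵇ top) * incrRowsTop m k top h
      ≡⟨ cong₂ _+_ (∑-≡0 (labels t) λ a →
                     *-≡0 (𝟙 (b ≤ᵇ a)) (incrRowsTop-short m (suc k) a (h ∘ (a ∷_)) (m<n⇒m<1+n m<k)))
                   (*-≡0 (𝟙 (b ≤ᵇ top)) (incrRowsTop-short m k top h m<k)) ⟩
    0 ∎
    where open ≡-Reasoning

  incrRowsTop-exact : ∀ j k b h → b ≤ top → incrRowsTop (j + k) k b h ≡ incrRows t j b h
  incrRowsTop-exact zero    zero    b h _     = refl
  incrRowsTop-exact zero    (suc k) b h b≤top = begin
    incrRowsTop (suc k) (suc k) b h
      ≡⟨ incrRowsTop-suc k (suc k) b h ⟩
    ∑ (labels t) (λ a → 𝟙 (b ≤ᵇ a) * incrRowsTop k (suc k) a (h ∘ (a ∷_)))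
      + 𝟙 (b ≤ᵇ top) * incrRowsTop k k top h
      ≡⟨ cong₂ _+_ (∑-≡0 (labels t) λ a →
                     *-≡0 (𝟙 (b ≤ᵇ a)) (incrRowsTop-short k (suc k) a (h ∘ (a ∷_)) ≤-refl))
                   (cong₂ _*_ (cong 𝟙 (≤⇒≤ᵇ≡true b≤top)) (incrRowsTop-exact zero k top h ≤-refl)) ⟩
    1 * incrRows t 0 b h
      ≡⟨ *-identityˡ _ ⟩
    incrRows t 0 b h ∎
    where open ≡-Reasoning
  incrRowsTop-exact (suc j) k b h b≤top = begin
    incrRowsTop (suc (j + k)) k b h
      ≡⟨ incrRowsTop-suc (j + k) k b h ⟩
    ∑ (labels t) (λ a → 𝟙 (b ≤ᵇ a) * incrRowsTop (j + k) k a (h ∘ (a ∷_)))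
      + 𝟙 (b ≤ᵇ top) * startingWithTop (j + k) k h
      ≡⟨ cong₂ _+_ (∑-cong-All (All.map below (labels-≤ t))) (*-≡0 (𝟙 (b ≤ᵇ top)) (noTopStart k)) ⟩
    ∑ (labels t) (λ a → 𝟙 (b ≤ᵇ a) * incrRows t j a (h ∘ (a ∷_))) + 0
      ≡⟨ +-identityʳ _ ⟩
    ∑ (labels t) (λ a → 𝟙 (b ≤ᵇ a) * incrRows t j a (h ∘ (a ∷_)))
      ≡⟨ incrRows-suc t j b h ⟨
    incrRows t (suc j) b h ∎
    where
    open ≡-Reasoning
    below : ∀ {a} → a ≤ t →
      𝟙 (b ≤ᵇ a) * incrRowsTop (j + k) k a (h ∘ (a ∷_)) ≡ 𝟙 (b ≤ᵇ a) * incrRows t j a (h ∘ (a ∷_))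
    below {a} a≤t = cong (𝟙 (b ≤ᵇ a) *_) (incrRowsTop-exact j k a (h ∘ (a ∷_)) (m≤n⇒m≤1+n a≤t))

    -- a row that starts with the top label has no room for the j + 1 smaller labels
    noTopStart : ∀ k → startingWithTop (j + k) k h ≡ 0
    noTopStart zero    = refl
    noTopStart (suc k) = begin
      incrRowsTop (j + suc k) k top h  ≡⟨ cong (λ l → incrRowsTop l k top h) (+-suc j k) ⟩
      incrRowsTop (suc j + k) k top h  ≡⟨ incrRowsTop-exact (suc j) k top h ≤-refl ⟩
      incrRows t (suc j) top h         ≡⟨ incrRows-above t j top h ≤-refl ⟩
      0                                ∎

  incrRowsTop≡ : ∀ l k b h → b ≤ top → incrRowsTop l k b h ≡ 𝟙 (k ≤ᵇ l) * incrRows t (l ∸ k) b h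
  incrRowsTop≡ l k b h b≤top with k ≤? l
  ... | yes k≤l = begin
    incrRowsTop l k b h                  ≡⟨ cong (λ n → incrRowsTop n k b h) (m∸n+n≡m k≤l) ⟨
    incrRowsTop (l ∸ k + k) k b h        ≡⟨ incrRowsTop-exact (l ∸ k) k b h b≤top ⟩
    incrRows t (l ∸ k) b h               ≡⟨ *-identityˡ _ ⟨
    1 * incrRows t (l ∸ k) b h           ≡⟨ cong (λ z → 𝟙 z * incrRows t (l ∸ k) b h) (≤⇒≤ᵇ≡true k≤l) ⟨
    𝟙 (k ≤ᵇ l) * incrRows t (l ∸ k) b h  ∎
    where open ≡-Reasoning
  ... | no k≰l = trans (incrRowsTop-short l k b h (≰⇒> k≰l))
                       (cong (λ z → 𝟙 z * incrRows t (l ∸ k) b h) (sym (<⇒≤ᵇ≡false (≰⇒> k≰l))))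

  incrWithTop : ℕ → List ℕ → Bool
  incrWithTop k r = weaklyIncr r ∧ (occ top r ≡ᵇ k)

  -- A weakly increasing row with k top labels is a weakly increasing row on the
  -- labels 1 … t followed by k top labels.
  ∑-rowsOf-top : ∀ l k h →
    ∑ (rowsOf l top) (λ r → 𝟙 (incrWithTop k r) * h (removeAll top r))
      ≡ 𝟙 (k ≤ᵇ l) * ∑ (rowsOf (l ∸ k) t) (λ r → 𝟙 (weaklyIncr r) * h r)
  ∑-rowsOf-top l k h = begin
    ∑ (rowsOf l top) (λ r → 𝟙 (incrWithTop k r) * h (removeAll top r))
      ≡⟨ ∑-cong (rowsOf l top) (λ r → cong (λ w → 𝟙 (w ∧ (occ top r ≡ᵇ k)) * h (removeAll top r))
                                           (weaklyIncr≡incrFrom-0 r)) ⟩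
    incrRowsTop l k 0 h
      ≡⟨ incrRowsTop≡ l k 0 h z≤n ⟩
    𝟙 (k ≤ᵇ l) * incrRows t (l ∸ k) 0 h
      ≡⟨ cong (𝟙 (k ≤ᵇ l) *_) (∑-cong (rowsOf (l ∸ k) t) λ r →
                                 cong (λ w → 𝟙 w * h r) (weaklyIncr≡incrFrom-0 r)) ⟨
    𝟙 (k ≤ᵇ l) * ∑ (rowsOf (l ∸ k) t) (λ r → 𝟙 (weaklyIncr r) * h r) ∎
    where open ≡-Reasoning

  incrNoTop : List (List ℕ) → Bool
  incrNoTop F = allRowsIncr F ∧ (occ top (concat F) ≡ᵇ 0)

  incrTopBrick : ℕ → List (List ℕ) → Bool
  incrTopBrick L F = allRowsIncr F ∧ labelOK F (top , L)

  incrNoTop-∷ : ∀ r F → 𝟙 (incrNoTop (r ∷ F)) ≡ 𝟙 (incrWithTop 0 r) * 𝟙 (incrNoTop F)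
  incrNoTop-∷ r F = begin
    𝟙 ((weaklyIncr r ∧ allRowsIncr F) ∧ (occ top (r ++ concat F) ≡ᵇ 0))
      ≡⟨ cong (λ n → 𝟙 ((weaklyIncr r ∧ allRowsIncr F) ∧ (n ≡ᵇ 0))) (occ-++ top r (concat F)) ⟩
    𝟙 ((weaklyIncr r ∧ allRowsIncr F) ∧ (occ top r + occ top (concat F) ≡ᵇ 0))
      ≡⟨ cong (λ b → 𝟙 ((weaklyIncr r ∧ allRowsIncr F) ∧ b)) (+-≡ᵇ-0 (occ top r) _) ⟩
    𝟙 ((weaklyIncr r ∧ allRowsIncr F) ∧ ((occ top r ≡ᵇ 0) ∧ (occ top (concat F) ≡ᵇ 0)))
      ≡⟨ cong 𝟙 (∧-interchange (weaklyIncr r) (allRowsIncr F) _ _) ⟩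
    𝟙 (incrWithTop 0 r ∧ incrNoTop F)
      ≡⟨ 𝟙-∧ (incrWithTop 0 r) (incrNoTop F) ⟩
    𝟙 (incrWithTop 0 r) * 𝟙 (incrNoTop F) ∎
    where open ≡-Reasoning

  incrTopBrick-∷ : ∀ L r F → 𝟙 (incrTopBrick (suc L) (r ∷ F)) ≡
    𝟙 (incrWithTop (suc L) r) * 𝟙 (incrNoTop F) + 𝟙 (incrWithTop 0 r) * 𝟙 (incrTopBrick (suc L) F)
  incrTopBrick-∷ L r F = byTopCount (occ top r) refl
    where
    rhs : ℕ → ℕ
    rhs o = 𝟙 (weaklyIncr r ∧ (o ≡ᵇ suc L)) * 𝟙 (incrNoTop F)
          + 𝟙 (weaklyIncr r ∧ (o ≡ᵇ 0)) * 𝟙 (incrTopBrick (suc L) F)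

    topAbsent : ∀ w → 𝟙 ((w ∧ allRowsIncr F) ∧ labelOK F (top , suc L)) ≡
      𝟙 (w ∧ false) * 𝟙 (incrNoTop F) + 𝟙 (w ∧ true) * 𝟙 (incrTopBrick (suc L) F)
    topAbsent false = refl
    topAbsent true  = sym (+-identityʳ _)

    topPresent : ∀ w W e → 𝟙 ((w ∧ W) ∧ (e ∧ (occ top (concat F) ≡ᵇ 0))) ≡
      𝟙 (w ∧ e) * 𝟙 (W ∧ (occ top (concat F) ≡ᵇ 0)) + 𝟙 (w ∧ false) * 𝟙 (incrTopBrick (suc L) F)
    topPresent false W     e     = refl
    topPresent true  false e     = sym (trans (+-identityʳ _) (*-zeroʳ (𝟙 e)))
    topPresent true  true  false = refl
    topPresent true  true  true  = sym (trans (+-identityʳ _) (*-identityˡ _))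

    byTopCount : ∀ o → occ top r ≡ o → 𝟙 (incrTopBrick (suc L) (r ∷ F)) ≡ rhs (occ top r)
    byTopCount zero    occ≡ = trans
      (cong (λ b → 𝟙 ((weaklyIncr r ∧ allRowsIncr F) ∧ b)) (labelOK-∷-absent r F (suc L) occ≡))
      (trans (topAbsent (weaklyIncr r)) (sym (cong rhs occ≡)))
    byTopCount (suc o) occ≡ = trans
      (cong (λ b → 𝟙 ((weaklyIncr r ∧ allRowsIncr F) ∧ b)) (labelOK-∷-present r F (suc L) occ≡))
      (trans (topPresent (weaklyIncr r) (allRowsIncr F) (o ≡ᵇ L)) (sym (cong rhs occ≡)))

  stripTop : List (List ℕ) → List (List ℕ)
  stripTop = map (removeAll top)

  ∑-incrNoTop : ∀ ν Ψ →
    ∑ (fillings ν top) (λ F → 𝟙 (incrNoTop F) * Ψ (stripTop F)) ≡ incrFillings t ν Ψ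
  ∑-incrNoTop []      Ψ = refl
  ∑-incrNoTop (l ∷ ν) Ψ = begin
    ∑ (fillings (l ∷ ν) top) (λ F → 𝟙 (incrNoTop F) * Ψ (stripTop F))
      ≡⟨ ∑-fillings-∷ l ν top _ ⟩
    ∑ (rowsOf l top) (λ r → ∑ (fillings ν top) (λ F → 𝟙 (incrNoTop (r ∷ F)) * Ψ (stripTop (r ∷ F))))
      ≡⟨ ∑-cong (rowsOf l top) peel ⟩
    ∑ (rowsOf l top) (λ r → 𝟙 (incrWithTop 0 r) * X (removeAll top r))
      ≡⟨ ∑-rowsOf-top l 0 X ⟩
    1 * ∑ (rowsOf l t) (λ r → 𝟙 (weaklyIncr r) * X r)
      ≡⟨ *-identityˡ _ ⟩
    ∑ (rowsOf l t) (λ r → 𝟙 (weaklyIncr r) * X r)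
      ≡⟨ incrFillings-∷ t l ν Ψ ⟨
    incrFillings t (l ∷ ν) Ψ ∎
    where
    open ≡-Reasoning
    X : List ℕ → ℕ
    X r = incrFillings t ν (Ψ ∘ (r ∷_))

    peel : ∀ r → ∑ (fillings ν top) (λ F → 𝟙 (incrNoTop (r ∷ F)) * Ψ (stripTop (r ∷ F)))
               ≡ 𝟙 (incrWithTop 0 r) * X (removeAll top r)
    peel r = begin
      ∑ (fillings ν top) (λ F → 𝟙 (incrNoTop (r ∷ F)) * Ψr F)
        ≡⟨ ∑-cong (fillings ν top) (λ F → cong (_* Ψr F) (incrNoTop-∷ r F)) ⟩
      ∑ (fillings ν top) (λ F → 𝟙 (incrWithTop 0 r) * 𝟙 (incrNoTop F) * Ψr F)
        ≡⟨ ∑-*ˡ-* (fillings ν top) (𝟙 (incrWithTop 0 r)) (𝟙 ∘ incrNoTop) Ψr ⟩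
      𝟙 (incrWithTop 0 r) * ∑ (fillings ν top) (λ F → 𝟙 (incrNoTop F) * Ψr F)
        ≡⟨ cong (𝟙 (incrWithTop 0 r) *_) (∑-incrNoTop ν (Ψ ∘ (removeAll top r ∷_))) ⟩
      𝟙 (incrWithTop 0 r) * X (removeAll top r) ∎
      where
      Ψr : List (List ℕ) → ℕ
      Ψr F = Ψ (stripTop (r ∷ F))

  ∑-incrTopBrick : ∀ L ν Ψ →
    ∑ (fillings ν top) (λ F → 𝟙 (incrTopBrick (suc L) F) * Ψ (stripTop F))
      ≡ ∑ (removeBrick (suc L) ν) (λ μ → incrFillings t μ Ψ)
  ∑-incrTopBrick L []      Ψ = refl
  ∑-incrTopBrick L (l ∷ ν) Ψ = begin
    ∑ (fillings (l ∷ ν) top) (λ F → 𝟙 (incrTopBrick (suc L) F) * Ψ (stripTop F))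
      ≡⟨ ∑-fillings-∷ l ν top _ ⟩
    ∑ (rowsOf l top) (λ r →
      ∑ (fillings ν top) (λ F → 𝟙 (incrTopBrick (suc L) (r ∷ F)) * Ψ (stripTop (r ∷ F))))
      ≡⟨ ∑-cong (rowsOf l top) peel ⟩
    ∑ (rowsOf l top) (λ r → 𝟙 (incrWithTop (suc L) r) * X (removeAll top r)
                          + 𝟙 (incrWithTop 0 r) * Y (removeAll top r))
      ≡⟨ ∑-distrib-+ (rowsOf l top) _ _ ⟩
    ∑ (rowsOf l top) (λ r → 𝟙 (incrWithTop (suc L) r) * X (removeAll top r))
      + ∑ (rowsOf l top) (λ r → 𝟙 (incrWithTop 0 r) * Y (removeAll top r))
      ≡⟨ cong₂ _+_ (∑-rowsOf-top l (suc L) X) (∑-rowsOf-top l 0 Y) ⟩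
    𝟙 (suc L ≤ᵇ l) * ∑ (rowsOf (l ∸ suc L) t) (λ r → 𝟙 (weaklyIncr r) * X r)
      + 1 * ∑ (rowsOf l t) (λ r → 𝟙 (weaklyIncr r) * Y r)
      ≡⟨ cong₂ _+_ (cong (𝟙 (suc L ≤ᵇ l) *_) (sym (incrFillings-∷ t (l ∸ suc L) ν Ψ)))
                   (trans (*-identityˡ _) commute) ⟩
    𝟙 (suc L ≤ᵇ l) * incrFillings t ((l ∸ suc L) ∷ ν) Ψ
      + ∑ (removeBrick (suc L) ν) (λ μ → incrFillings t (l ∷ μ) Ψ)
      ≡⟨ ∑-removeBrick-∷ (suc L) l ν (λ μ → incrFillings t μ Ψ) ⟨
    ∑ (removeBrick (suc L) (l ∷ ν)) (λ μ → incrFillings t μ Ψ) ∎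
    where
    open ≡-Reasoning
    X Y : List ℕ → ℕ
    X r = incrFillings t ν (Ψ ∘ (r ∷_))
    Y r = ∑ (removeBrick (suc L) ν) (λ μ → incrFillings t μ (Ψ ∘ (r ∷_)))

    peel : ∀ r →
      ∑ (fillings ν top) (λ F → 𝟙 (incrTopBrick (suc L) (r ∷ F)) * Ψ (stripTop (r ∷ F)))
        ≡ 𝟙 (incrWithTop (suc L) r) * X (removeAll top r) + 𝟙 (incrWithTop 0 r) * Y (removeAll top r)
    peel r = begin
      ∑ (fillings ν top) (λ F → 𝟙 (incrTopBrick (suc L) (r ∷ F)) * Ψr F)
        ≡⟨ ∑-cong (fillings ν top) expand ⟩
      ∑ (fillings ν top) (λ F → cᴸ * 𝟙 (incrNoTop F) * Ψr F + c⁰ * 𝟙 (incrTopBrick (suc L) F) * Ψr F)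
        ≡⟨ ∑-distrib-+ (fillings ν top) _ _ ⟩
      ∑ (fillings ν top) (λ F → cᴸ * 𝟙 (incrNoTop F) * Ψr F)
        + ∑ (fillings ν top) (λ F → c⁰ * 𝟙 (incrTopBrick (suc L) F) * Ψr F)
        ≡⟨ cong₂ _+_ (∑-*ˡ-* (fillings ν top) cᴸ (𝟙 ∘ incrNoTop) Ψr)
                     (∑-*ˡ-* (fillings ν top) c⁰ (𝟙 ∘ incrTopBrick (suc L)) Ψr) ⟩
      cᴸ * ∑ (fillings ν top) (λ F → 𝟙 (incrNoTop F) * Ψr F)
        + c⁰ * ∑ (fillings ν top) (λ F → 𝟙 (incrTopBrick (suc L) F) * Ψr F)
        ≡⟨ cong₂ _+_ (cong (cᴸ *_) (∑-incrNoTop ν (Ψ ∘ (removeAll top r ∷_))))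
                     (cong (c⁰ *_) (∑-incrTopBrick L ν (Ψ ∘ (removeAll top r ∷_)))) ⟩
      cᴸ * X (removeAll top r) + c⁰ * Y (removeAll top r) ∎
      where
      cᴸ c⁰ : ℕ
      cᴸ = 𝟙 (incrWithTop (suc L) r)
      c⁰ = 𝟙 (incrWithTop 0 r)
      Ψr : List (List ℕ) → ℕ
      Ψr F = Ψ (stripTop (r ∷ F))
      expand : ∀ F → 𝟙 (incrTopBrick (suc L) (r ∷ F)) * Ψr F
                   ≡ cᴸ * 𝟙 (incrNoTop F) * Ψr F + c⁰ * 𝟙 (incrTopBrick (suc L) F) * Ψr F
      expand F = trans (cong (_* Ψr F) (incrTopBrick-∷ L r F))
                       (*-distribʳ-+ (Ψr F) (cᴸ * 𝟙 (incrNoTop F)) (c⁰ * 𝟙 (incrTopBrick (suc L) F)))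

    commute : ∑ (rowsOf l t) (λ r → 𝟙 (weaklyIncr r) * Y r)
            ≡ ∑ (removeBrick (suc L) ν) (λ μ → incrFillings t (l ∷ μ) Ψ)
    commute = begin
      ∑ (rowsOf l t) (λ r → 𝟙 (weaklyIncr r) * Y r)
        ≡⟨ ∑-cong (rowsOf l t) (λ r → ∑-*ˡ (removeBrick (suc L) ν) (𝟙 (weaklyIncr r)) _) ⟨
      ∑ (rowsOf l t) (λ r →
        ∑ (removeBrick (suc L) ν) (λ μ → 𝟙 (weaklyIncr r) * incrFillings t μ (Ψ ∘ (r ∷_))))
        ≡⟨ ∑-comm (rowsOf l t) (removeBrick (suc L) ν) _ ⟩
      ∑ (removeBrick (suc L) ν) (λ μ →
        ∑ (rowsOf l t) (λ r → 𝟙 (weaklyIncr r) * incrFillings t μ (Ψ ∘ (r ∷_))))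
        ≡⟨ ∑-cong (removeBrick (suc L) ν) (λ μ → incrFillings-∷ t l μ Ψ) ⟨
      ∑ (removeBrick (suc L) ν) (λ μ → incrFillings t (l ∷ μ) Ψ) ∎

numOBT-∷ʳ : ∀ ν β L → numOBT ν (β ∷ʳ suc L) ≡ ∑ (removeBrick (suc L) ν) (λ μ → numOBT μ β)
numOBT-∷ʳ ν β L = begin
  numOBT ν (β ∷ʳ suc L)
    ≡⟨ numOBT≡∑ ν (β ∷ʳ suc L) ⟩
  ∑ (fillings ν (length (β ∷ʳ suc L))) (𝟙 ∘ isOBT (β ∷ʳ suc L))
    ≡⟨ cong (λ n → ∑ (fillings ν n) (𝟙 ∘ isOBT (β ∷ʳ suc L))) (length-∷ʳ β (suc L)) ⟩
  ∑ (fillings ν (suc (length β))) (𝟙 ∘ isOBT (β ∷ʳ suc L))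
    ≡⟨ ∑-cong (fillings ν (suc (length β))) split ⟩
  ∑ (fillings ν (suc (length β))) (λ F → 𝟙 (incrTopBrick (suc L) F) * 𝟙 (labelsOK β (stripTop F)))
    ≡⟨ ∑-incrTopBrick L ν (𝟙 ∘ labelsOK β) ⟩
  ∑ (removeBrick (suc L) ν) (λ μ → incrFillings (length β) μ (𝟙 ∘ labelsOK β))
    ≡⟨ ∑-cong (removeBrick (suc L) ν) (λ μ → numOBT≡incrFillings μ β) ⟨
  ∑ (removeBrick (suc L) ν) (λ μ → numOBT μ β) ∎
  where
  open ≡-Reasoning
  open TopLabel (length β)
  split : ∀ F → 𝟙 (isOBT (β ∷ʳ suc L) F) ≡ 𝟙 (incrTopBrick (suc L) F) * 𝟙 (labelsOK β (stripTop F))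
  split F = begin
    𝟙 (isOBT (β ∷ʳ suc L) F)
      ≡⟨ cong 𝟙 (isOBT-∷ʳ β (suc L) F) ⟩
    𝟙 (allRowsIncr F ∧ (labelsOK β F ∧ labelOK F (suc (length β) , suc L)))
      ≡⟨ cong (λ b → 𝟙 (allRowsIncr F ∧ b)) (∧-comm (labelsOK β F) _) ⟩
    𝟙 (allRowsIncr F ∧ (labelOK F (suc (length β) , suc L) ∧ labelsOK β F))
      ≡⟨ cong 𝟙 (∧-assoc (allRowsIncr F) _ (labelsOK β F)) ⟨
    𝟙 (incrTopBrick (suc L) F ∧ labelsOK β F)
      ≡⟨ 𝟙-∧ (incrTopBrick (suc L) F) (labelsOK β F) ⟩
    𝟙 (incrTopBrick (suc L) F) * 𝟙 (labelsOK β F)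
      ≡⟨ cong (λ b → 𝟙 (incrTopBrick (suc L) F) * 𝟙 b) (labelsOK-removeAll β F ≤-refl) ⟨
    𝟙 (incrTopBrick (suc L) F) * 𝟙 (labelsOK β (stripTop F)) ∎

-- Permuting rows and deleting empty rows

numOBT-[] : ∀ ν → numOBT ν [] ≡ 𝟙 (sum ν ≡ᵇ 0)
numOBT-[] ν = trans (numOBT≡∑ ν []) (emptyContent ν)
  where
  emptyContent : ∀ ν → ∑ (fillings ν 0) (𝟙 ∘ isOBT []) ≡ 𝟙 (sum ν ≡ᵇ 0)
  emptyContent []          = refl
  emptyContent (zero ∷ ν)  = trans (∑-fillings-∷ zero ν 0 _) (trans (+-identityʳ _) (emptyContent ν))
  emptyContent (suc l ∷ ν) = ∑-fillings-∷ (suc l) ν 0 (𝟙 ∘ isOBT [])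

positive-∷ʳ-induction : (P : List ℕ → Set) → P [] → (∀ β L → P β → P (β ∷ʳ suc L)) →
  ∀ β → All (0 <_) β → P β
positive-∷ʳ-induction P base step β = go (reverseView β)
  where
  go : ∀ {β} → Reverse β → All (0 <_) β → P β
  go []                  _   = base
  go (β ∶ rβ ∶ʳ zero)    pos with () ← proj₂ (∷ʳ⁻ pos)
  go (β ∶ rβ ∶ʳ suc L)   pos = step β L (go rβ (proj₁ (∷ʳ⁻ pos)))

∑-removeBrick-∷∷ : ∀ L x y ν g → ∑ (removeBrick L (x ∷ y ∷ ν)) g ≡
  𝟙 (L ≤ᵇ x) * g ((x ∸ L) ∷ y ∷ ν)
    + (𝟙 (L ≤ᵇ y) * g (x ∷ (y ∸ L) ∷ ν) + ∑ (removeBrick L ν) (λ κ → g (x ∷ y ∷ κ)))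
∑-removeBrick-∷∷ L x y ν g = trans (∑-removeBrick-∷ L x (y ∷ ν) g)
  (cong (𝟙 (L ≤ᵇ x) * g ((x ∸ L) ∷ y ∷ ν) +_) (∑-removeBrick-∷ L y ν (g ∘ (x ∷_))))

∑-removeBrick-↭ : ∀ L {g : List ℕ → ℕ} → g Preserves _↭_ ⟶ _≡_ →
  (λ ν → ∑ (removeBrick L ν) g) Preserves _↭_ ⟶ _≡_
∑-removeBrick-↭ L g-↭ ↭-refl = refl
∑-removeBrick-↭ L {g} g-↭ (↭-prep {ν} {μ} x p) = begin
  ∑ (removeBrick L (x ∷ ν)) g
    ≡⟨ ∑-removeBrick-∷ L x ν g ⟩
  𝟙 (L ≤ᵇ x) * g ((x ∸ L) ∷ ν) + ∑ (removeBrick L ν) (g ∘ (x ∷_))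
    ≡⟨ cong₂ _+_ (cong (𝟙 (L ≤ᵇ x) *_) (g-↭ (↭-prep (x ∸ L) p)))
                 (∑-removeBrick-↭ L (g-↭ ∘ ↭-prep x) p) ⟩
  𝟙 (L ≤ᵇ x) * g ((x ∸ L) ∷ μ) + ∑ (removeBrick L μ) (g ∘ (x ∷_))
    ≡⟨ ∑-removeBrick-∷ L x μ g ⟨
  ∑ (removeBrick L (x ∷ μ)) g ∎
  where open ≡-Reasoning
∑-removeBrick-↭ L {g} g-↭ (↭-swap {ν} {μ} x y p) = begin
  ∑ (removeBrick L (x ∷ y ∷ ν)) g
    ≡⟨ ∑-removeBrick-∷∷ L x y ν g ⟩
  shortenX + (shortenY + rest)
    ≡⟨ +-left-commute shortenX shortenY rest ⟩
  shortenY + (shortenX + rest)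
    ≡⟨ cong₂ _+_ (cong (𝟙 (L ≤ᵇ y) *_) (g-↭ (↭-swap x (y ∸ L) p)))
                 (cong₂ _+_ (cong (𝟙 (L ≤ᵇ x) *_) (g-↭ (↭-swap (x ∸ L) y p))) rest≡) ⟩
  shortenY′ + (shortenX′ + rest′)
    ≡⟨ ∑-removeBrick-∷∷ L y x μ g ⟨
  ∑ (removeBrick L (y ∷ x ∷ μ)) g ∎
  where
  open ≡-Reasoning
  shortenX shortenY rest shortenX′ shortenY′ rest′ : ℕ
  shortenX  = 𝟙 (L ≤ᵇ x) * g ((x ∸ L) ∷ y ∷ ν)
  shortenY  = 𝟙 (L ≤ᵇ y) * g (x ∷ (y ∸ L) ∷ ν)
  rest      = ∑ (removeBrick L ν) (λ κ → g (x ∷ y ∷ κ))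
  shortenX′ = 𝟙 (L ≤ᵇ x) * g (y ∷ (x ∸ L) ∷ μ)
  shortenY′ = 𝟙 (L ≤ᵇ y) * g ((y ∸ L) ∷ x ∷ μ)
  rest′     = ∑ (removeBrick L μ) (λ κ → g (y ∷ x ∷ κ))
  rest≡ : rest ≡ rest′
  rest≡ = trans (∑-removeBrick-↭ L (λ q → g-↭ (↭-prep x (↭-prep y q))) p)
                (∑-cong (removeBrick L μ) (λ κ → g-↭ (↭-swap x y ↭-refl)))
∑-removeBrick-↭ L g-↭ (↭-trans p q) = trans (∑-removeBrick-↭ L g-↭ p) (∑-removeBrick-↭ L g-↭ q)

numOBT-↭ : ∀ β → All (0 <_) β → (λ ν → numOBT ν β) Preserves _↭_ ⟶ _≡_
numOBT-↭ = positive-∷ʳ-induction _ base step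
  where
  base : (λ ν → numOBT ν []) Preserves _↭_ ⟶ _≡_
  base {ν} {μ} p = trans (numOBT-[] ν) (trans (cong (λ n → 𝟙 (n ≡ᵇ 0)) (sum-↭ p)) (sym (numOBT-[] μ)))
  step : ∀ β L → (λ ν → numOBT ν β) Preserves _↭_ ⟶ _≡_ →
    (λ ν → numOBT ν (β ∷ʳ suc L)) Preserves _↭_ ⟶ _≡_
  step β L numOBT-β-↭ {ν} {μ} p =
    trans (numOBT-∷ʳ ν β L) (trans (∑-removeBrick-↭ (suc L) numOBT-β-↭ p) (sym (numOBT-∷ʳ μ β L)))

numOBT-∷-zero : ∀ β → All (0 <_) β → ∀ ν → numOBT (0 ∷ ν) β ≡ numOBT ν β
numOBT-∷-zero = positive-∷ʳ-induction _ (λ ν → trans (numOBT-[] (0 ∷ ν)) (sym (numOBT-[] ν))) step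
  where
  step : ∀ β L → (∀ ν → numOBT (0 ∷ ν) β ≡ numOBT ν β) →
    ∀ ν → numOBT (0 ∷ ν) (β ∷ʳ suc L) ≡ numOBT ν (β ∷ʳ suc L)
  step β L ih ν = begin
    numOBT (0 ∷ ν) (β ∷ʳ suc L)                                ≡⟨ numOBT-∷ʳ (0 ∷ ν) β L ⟩
    ∑ (map (0 ∷_) (removeBrick (suc L) ν)) (λ μ → numOBT μ β)   ≡⟨ ∑-map (0 ∷_) (removeBrick (suc L) ν) _ ⟩
    ∑ (removeBrick (suc L) ν) (λ μ → numOBT (0 ∷ μ) β)          ≡⟨ ∑-cong (removeBrick (suc L) ν) ih ⟩
    ∑ (removeBrick (suc L) ν) (λ μ → numOBT μ β)                ≡⟨ numOBT-∷ʳ ν β L ⟨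
    numOBT ν (β ∷ʳ suc L)                                      ∎
    where open ≡-Reasoning

insertDesc-↭ : ∀ a xs → insertDesc a xs ↭ a ∷ xs
insertDesc-↭ a []       = ↭-refl
insertDesc-↭ a (x ∷ xs) with x ≤ᵇ a
... | true  = ↭-refl
... | false = ↭-trans (↭-prep x (insertDesc-↭ a xs)) (↭-swap x a ↭-refl)

sortDesc-↭ : ∀ xs → sortDesc xs ↭ xs
sortDesc-↭ []       = ↭-refl
sortDesc-↭ (x ∷ xs) = ↭-trans (insertDesc-↭ x (sortDesc xs)) (↭-prep x (sortDesc-↭ xs))

orderedPair : ℕ → ℕ → List ℕ → List ℕ
orderedPair a b ys = if b ≤ᵇ a then a ∷ b ∷ ys else b ∷ a ∷ ys

orderedPair-comm : ∀ a b ys → orderedPair a b ys ≡ orderedPair b a ys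
orderedPair-comm a b ys with <-cmp a b
... | tri< a<b _ _ rewrite <⇒≤ᵇ≡false a<b | ≤⇒≤ᵇ≡true (<⇒≤ a<b) = refl
... | tri≈ _ refl _ = refl
... | tri> _ _ b<a rewrite <⇒≤ᵇ≡false b<a | ≤⇒≤ᵇ≡true (<⇒≤ b<a) = refl

insertDesc-comm : ∀ a b xs → insertDesc a (insertDesc b xs) ≡ insertDesc b (insertDesc a xs)
insertDesc-comm a b []       = orderedPair-comm a b []
insertDesc-comm a b (x ∷ xs) with x ≤ᵇ a in x≤a | x ≤ᵇ b in x≤b
... | true  | true  rewrite x≤a | x≤b = orderedPair-comm a b (x ∷ xs)
... | true  | false rewrite x≤a | x≤b | <⇒≤ᵇ≡false (<-≤-trans (≤ᵇ≡false⇒> x b x≤b) (≤ᵇ≡true⇒≤ x a x≤a))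
  = refl
... | false | true  rewrite x≤a | x≤b | <⇒≤ᵇ≡false (<-≤-trans (≤ᵇ≡false⇒> x a x≤a) (≤ᵇ≡true⇒≤ x b x≤b))
  = refl
... | false | false rewrite x≤a | x≤b = cong (x ∷_) (insertDesc-comm a b xs)

sortDesc-cong-↭ : ∀ {xs ys} → xs ↭ ys → sortDesc xs ≡ sortDesc ys
sortDesc-cong-↭ ↭-refl          = refl
sortDesc-cong-↭ (↭-prep x p)    = cong (insertDesc x) (sortDesc-cong-↭ p)
sortDesc-cong-↭ (↭-swap {ys = ys} x y p) rewrite sortDesc-cong-↭ p = insertDesc-comm x y (sortDesc ys)
sortDesc-cong-↭ (↭-trans p q)   = trans (sortDesc-cong-↭ p) (sortDesc-cong-↭ q)

replacePart-cong-↭ : ∀ L i {rest rest′} → rest ↭ rest′ → replacePart L i rest ≡ replacePart L i rest′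
replacePart-cong-↭ L i p with i ∸ L
... | zero  = sortDesc-cong-↭ p
... | suc k = sortDesc-cong-↭ (↭-prep (suc k) p)

numOBT-replacePart : ∀ β → All (0 <_) β → ∀ L i rest →
  numOBT ((i ∸ L) ∷ rest) β ≡ numOBT (replacePart L i rest) β
numOBT-replacePart β pos L i rest with i ∸ L
... | zero  = trans (numOBT-∷-zero β pos rest) (numOBT-↭ β pos (↭-sym (sortDesc-↭ rest)))
... | suc k = numOBT-↭ β pos (↭-sym (sortDesc-↭ (suc k ∷ rest)))

-- Multiplicities

occ-removeOne : ∀ c a xs → occ c (removeOne a xs) ≡ occ c xs ∸ 𝟙 (c ≡ᵇ a)
occ-removeOne c a []       = sym (0∸n≡0 (𝟙 (c ≡ᵇ a)))
occ-removeOne c a (x ∷ xs) with a ≟ x | c ≟ a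
... | yes refl | _        =
  sym (trans (cong (_∸ 𝟙 (c ≡ᵇ a)) (occ-∷ c a xs)) (m+n∸m≡n (𝟙 (c ≡ᵇ a)) (occ c xs)))
... | no  a≢x  | yes refl
  rewrite occ-∷ c x (removeOne c xs) | occ-∷ c x xs | ≢⇒≡ᵇ≡false a≢x | occ-removeOne c c xs | ≡ᵇ-refl c
  = refl
... | no  a≢x  | no  c≢a
  rewrite occ-∷ c x (removeOne a xs) | occ-∷ c x xs | occ-removeOne c a xs | ≢⇒≡ᵇ≡false c≢a = refl

occ-∖ : ∀ c xs ys → occ c (xs ∖ ys) ≡ occ c xs ∸ occ c ys
occ-∖ c xs []       = refl
occ-∖ c xs (y ∷ ys) = begin
  occ c (removeOne y (xs ∖ ys))         ≡⟨ occ-removeOne c y (xs ∖ ys) ⟩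
  occ c (xs ∖ ys) ∸ 𝟙 (c ≡ᵇ y)          ≡⟨ cong (_∸ 𝟙 (c ≡ᵇ y)) (occ-∖ c xs ys) ⟩
  occ c xs ∸ occ c ys ∸ 𝟙 (c ≡ᵇ y)      ≡⟨ ∸-+-assoc (occ c xs) (occ c ys) _ ⟩
  occ c xs ∸ (occ c ys + 𝟙 (c ≡ᵇ y))    ≡⟨ cong (occ c xs ∸_) (trans (+-comm (occ c ys) _) (sym (occ-∷ c y ys))) ⟩
  occ c xs ∸ occ c (y ∷ ys)             ∎
  where open ≡-Reasoning

occ-≡0⇒≡[] : ∀ xs → (∀ c → occ c xs ≡ 0) → xs ≡ []
occ-≡0⇒≡[] []       _    = refl
occ-≡0⇒≡[] (x ∷ xs) occ≡ with () ← trans (sym (occ-∷-≡ x xs)) (occ≡ x)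

occ-≡𝟙⇒≡[-] : ∀ xs i → (∀ c → occ c xs ≡ 𝟙 (c ≡ᵇ i)) → xs ≡ [ i ]
occ-≡𝟙⇒≡[-] []       i occ≡ with () ← trans (occ≡ i) (cong 𝟙 (≡ᵇ-refl i))
occ-≡𝟙⇒≡[-] (x ∷ xs) i occ≡ with x ≟ i
... | no x≢i   with () ← trans (sym (occ-∷-≡ x xs)) (trans (occ≡ x) (cong 𝟙 (≢⇒≡ᵇ≡false x≢i)))
... | yes refl = cong (x ∷_) (occ-≡0⇒≡[] xs (λ c →
  +-cancelˡ-≡ (𝟙 (c ≡ᵇ x)) (occ c xs) 0
    (trans (sym (occ-∷ c x xs)) (trans (occ≡ c) (sym (+-identityʳ _))))))

∖-replacePart : ∀ {ν i rest} L → ν ↭ i ∷ rest → suc L ≤ i → ν ∖ replacePart (suc L) i rest ≡ [ i ]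
∖-replacePart {ν} {i} {rest} L ν↭ L<i = occ-≡𝟙⇒≡[-] _ i λ c → begin
  occ c (ν ∖ replacePart (suc L) i rest)
    ≡⟨ occ-∖ c ν (replacePart (suc L) i rest) ⟩
  occ c ν ∸ occ c (replacePart (suc L) i rest)
    ≡⟨ cong (_∸ occ c (replacePart (suc L) i rest)) (trans (occ-↭ c ν↭) (occ-∷ c i rest)) ⟩
  𝟙 (c ≡ᵇ i) + occ c rest ∸ occ c (replacePart (suc L) i rest)
    ≡⟨ removed c ⟩
  𝟙 (c ≡ᵇ i) ∎
  where
  open ≡-Reasoning
  i∸L<i : i ∸ suc L < i
  i∸L<i = ∸-monoʳ-< {i} {suc L} {0} (s≤s z≤n) L<i

  removed : ∀ c → 𝟙 (c ≡ᵇ i) + occ c rest ∸ occ c (replacePart (suc L) i rest) ≡ 𝟙 (c ≡ᵇ i)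
  removed c with i ∸ suc L in i∸L≡
  ... | zero  rewrite occ-↭ c (sortDesc-↭ rest) = m+n∸n≡m (𝟙 (c ≡ᵇ i)) (occ c rest)
  ... | suc k rewrite occ-↭ c (sortDesc-↭ (suc k ∷ rest)) | occ-∷ c (suc k) rest with c ≟ i
  ...   | yes refl rewrite ≡ᵇ-refl c | ≢⇒≡ᵇ≡false (>⇒≢ (subst (_< c) i∸L≡ i∸L<i)) = m+n∸n≡m 1 (occ c rest)
  ...   | no  c≢i  rewrite ≢⇒≡ᵇ≡false c≢i = m≤n⇒m∸n≡0 (m≤n+m (occ c rest) (𝟙 (c ≡ᵇ suc k)))

multDiff-replacePart : ∀ {ν i rest} L → ν ↭ i ∷ rest → suc L ≤ i →
  multDiff ν (replacePart (suc L) i rest) ≡ occ i ν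
multDiff-replacePart L ν↭ L<i rewrite ∖-replacePart L ν↭ L<i = refl

module _ {A : Set} (_≟ᴬ_ : DecidableEquality A) where

  count : A → List A → ℕ
  count x xs = ∑ xs (λ y → 𝟙 (does (x ≟ᴬ y)))

  ∑-deduplicate : ∀ xs (f : A → ℕ) → ∑ xs f ≡ ∑ (deduplicate _≟ᴬ_ xs) (λ y → count y xs * f y)
  ∑-deduplicate []       f = refl
  ∑-deduplicate (x ∷ xs) f = begin
    f x + ∑ xs f
      ≡⟨ cong (f x +_) split ⟩
    f x + (count x xs * f x + ∑ xs others)
      ≡⟨ +-assoc (f x) _ _ ⟨
    suc (count x xs) * f x + ∑ xs others
      ≡⟨ cong₂ _+_ (cong (λ b → (𝟙 b + count x xs) * f x) (sym (dec-true (x ≟ᴬ x) refl)))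
                   (trans (∑-deduplicate xs others) (sym removeFirst)) ⟩
    count x (x ∷ xs) * f x
      + ∑ (filter (λ y → ¬? (x ≟ᴬ y)) (deduplicate _≟ᴬ_ xs)) (λ y → count y (x ∷ xs) * f y) ∎
    where
    open ≡-Reasoning
    others : A → ℕ
    others y = 𝟙 (not (does (x ≟ᴬ y))) * f y

    split : ∑ xs f ≡ count x xs * f x + ∑ xs others
    split = begin
      ∑ xs f
        ≡⟨ ∑-cong xs byEquality ⟩
      ∑ xs (λ y → 𝟙 (does (x ≟ᴬ y)) * f x + others y)
        ≡⟨ ∑-distrib-+ xs _ others ⟩
      ∑ xs (λ y → 𝟙 (does (x ≟ᴬ y)) * f x) + ∑ xs others
        ≡⟨ cong (_+ ∑ xs others) (∑-*ʳ xs _ (f x)) ⟩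
      count x xs * f x + ∑ xs others ∎
      where
      byEquality : ∀ y → f y ≡ 𝟙 (does (x ≟ᴬ y)) * f x + others y
      byEquality y with x ≟ᴬ y
      ... | yes refl = sym (trans (+-identityʳ _) (+-identityʳ (f x)))
      ... | no  _    = sym (+-identityʳ (f y))

    removeFirst : ∑ (filter (λ y → ¬? (x ≟ᴬ y)) (deduplicate _≟ᴬ_ xs)) (λ y → count y (x ∷ xs) * f y)
                ≡ ∑ (deduplicate _≟ᴬ_ xs) (λ y → count y xs * others y)
    removeFirst = trans (∑-filter (λ y → ¬? (x ≟ᴬ y)) (deduplicate _≟ᴬ_ xs) _)
                        (∑-cong (deduplicate _≟ᴬ_ xs) unchanged)
      where
      unchanged : ∀ y → 𝟙 (not (does (x ≟ᴬ y))) * (count y (x ∷ xs) * f y) ≡ count y xs * others y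
      unchanged y with x ≟ᴬ y | y ≟ᴬ x
      ... | yes refl | _        = sym (*-zeroʳ (count y xs))
      ... | no  x≢y  | yes refl = ⊥-elim (x≢y refl)
      ... | no  _    | no  _    = trans (+-identityʳ _) (cong (count y xs *_) (sym (+-identityʳ (f y))))

picks-↭ : ∀ ν → All (λ p → ν ↭ proj₁ p ∷ proj₂ p) (picks ν)
picks-↭ []      = []
picks-↭ (x ∷ ν) =
  ↭-refl ∷ map⁺ (All.map (λ {p} ν↭ → ↭-trans (↭-prep x ν↭) (↭-swap x (proj₁ p) ↭-refl)) (picks-↭ ν))

∑-picks-proj₁ : ∀ ν (h : ℕ → ℕ) → ∑ (picks ν) (h ∘ proj₁) ≡ ∑ ν h
∑-picks-proj₁ []      h = refl
∑-picks-proj₁ (x ∷ ν) h = cong (h x +_) (trans (∑-map _ (picks ν) (h ∘ proj₁)) (∑-picks-proj₁ ν h))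

∑-removeBrick-picks : ∀ L ν {g : List ℕ → ℕ} → g Preserves _↭_ ⟶ _≡_ →
  ∑ (removeBrick L ν) g ≡ ∑ (picks ν) (λ p → 𝟙 (L ≤ᵇ proj₁ p) * g ((proj₁ p ∸ L) ∷ proj₂ p))
∑-removeBrick-picks L []      g-↭ = refl
∑-removeBrick-picks L (x ∷ ν) {g} g-↭ = begin
  ∑ (removeBrick L (x ∷ ν)) g
    ≡⟨ ∑-removeBrick-∷ L x ν g ⟩
  𝟙 (L ≤ᵇ x) * g ((x ∸ L) ∷ ν) + ∑ (removeBrick L ν) (g ∘ (x ∷_))
    ≡⟨ cong (𝟙 (L ≤ᵇ x) * g ((x ∸ L) ∷ ν) +_) (∑-removeBrick-picks L ν (g-↭ ∘ ↭-prep x)) ⟩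
  𝟙 (L ≤ᵇ x) * g ((x ∸ L) ∷ ν) + ∑ (picks ν) (λ p → 𝟙 (L ≤ᵇ proj₁ p) * g (x ∷ (proj₁ p ∸ L) ∷ proj₂ p))
    ≡⟨ cong (𝟙 (L ≤ᵇ x) * g ((x ∸ L) ∷ ν) +_) (∑-cong (picks ν) λ p →
         cong (𝟙 (L ≤ᵇ proj₁ p) *_) (g-↭ (↭-swap x (proj₁ p ∸ L) ↭-refl))) ⟩
  𝟙 (L ≤ᵇ x) * g ((x ∸ L) ∷ ν) + ∑ (picks ν) (λ p → 𝟙 (L ≤ᵇ proj₁ p) * g ((proj₁ p ∸ L) ∷ x ∷ proj₂ p))
    ≡⟨ cong (𝟙 (L ≤ᵇ x) * g ((x ∸ L) ∷ ν) +_) (∑-map _ (picks ν) _) ⟨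
  ∑ (picks (x ∷ ν)) (λ p → 𝟙 (L ≤ᵇ proj₁ p) * g ((proj₁ p ∸ L) ∷ proj₂ p)) ∎
  where open ≡-Reasoning

_≟ᴸ_ : DecidableEquality (List ℕ)
_≟ᴸ_ = ≡-dec _≟_

-- S ν (suc L) unfolds to deduplicate _≟ᴸ_ removals.
module Removal (ν : List ℕ) (L : ℕ) where

  removal : ℕ × List ℕ → List ℕ
  removal p = replacePart (suc L) (proj₁ p) (proj₂ p)

  admissible : List (ℕ × List ℕ)
  admissible = filter (λ p → suc L ≤? proj₁ p) (picks ν)

  removals : List (List ℕ)
  removals = map removal admissible

  removal-injective : ∀ {p q} → suc L ≤ proj₁ p → suc L ≤ proj₁ q →
    ν ↭ proj₁ p ∷ proj₂ p → ν ↭ proj₁ q ∷ proj₂ q → removal p ≡ removal q → proj₁ p ≡ proj₁ q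
  removal-injective {p} {q} L<i L<j ν↭p ν↭q eq = ∷-injectiveˡ (begin
    [ proj₁ p ]     ≡⟨ ∖-replacePart L ν↭p L<i ⟨
    ν ∖ removal p   ≡⟨ cong (ν ∖_) eq ⟩
    ν ∖ removal q   ≡⟨ ∖-replacePart L ν↭q L<j ⟩
    [ proj₁ q ]     ∎)
    where open ≡-Reasoning

  removal≡⇔part≡ : ∀ p q → suc L ≤ proj₁ p → ν ↭ proj₁ p ∷ proj₂ p → ν ↭ proj₁ q ∷ proj₂ q →
    𝟙 (does (suc L ≤? proj₁ q)) * 𝟙 (does (removal p ≟ᴸ removal q)) ≡ 𝟙 (does (proj₁ p ≟ proj₁ q))
  removal≡⇔part≡ (i , rest) (j , rest′) L<i ν↭p ν↭q with i ≟ j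
  ... | yes refl rewrite dec-true (suc L ≤? i) L<i | ≡ᵇ-refl i
        | dec-true (removal (i , rest) ≟ᴸ removal (i , rest′))
                   (replacePart-cong-↭ (suc L) i (drop-∷ (↭-trans (↭-sym ν↭p) ν↭q)))
        = refl
  ... | no i≢j rewrite ≢⇒≡ᵇ≡false i≢j with suc L ≤? j
  ...   | no  L≰j rewrite dec-false (suc L ≤? j) L≰j = refl
  ...   | yes L<j rewrite dec-true (suc L ≤? j) L<j
        | dec-false (removal (i , rest) ≟ᴸ removal (j , rest′)) (i≢j ∘ removal-injective L<i L<j ν↭p ν↭q)
        = refl

  count-removal : ∀ p → suc L ≤ proj₁ p → ν ↭ proj₁ p ∷ proj₂ p →
    count _≟ᴸ_ (removal p) removals ≡ multDiff ν (removal p)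
  count-removal p L<i ν↭p = begin
    count _≟ᴸ_ (removal p) removals
      ≡⟨ ∑-map removal admissible _ ⟩
    ∑ admissible (λ q → 𝟙 (does (removal p ≟ᴸ removal q)))
      ≡⟨ ∑-filter (λ q → suc L ≤? proj₁ q) (picks ν) _ ⟩
    ∑ (picks ν) (λ q → 𝟙 (does (suc L ≤? proj₁ q)) * 𝟙 (does (removal p ≟ᴸ removal q)))
      ≡⟨ ∑-cong-All (All.map (removal≡⇔part≡ p _ L<i ν↭p) (picks-↭ ν)) ⟩
    ∑ (picks ν) (λ q → 𝟙 (does (proj₁ p ≟ proj₁ q)))
      ≡⟨ ∑-picks-proj₁ ν (λ y → 𝟙 (does (proj₁ p ≟ y))) ⟩
    ∑ ν (λ y → 𝟙 (does (proj₁ p ≟ y)))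
      ≡⟨ length-filter-∑ (proj₁ p ≟_) ν ⟨
    occ (proj₁ p) ν
      ≡⟨ multDiff-replacePart L ν↭p L<i ⟨
    multDiff ν (removal p) ∎
    where open ≡-Reasoning

  count≡multDiff : All (λ γ → count _≟ᴸ_ γ removals ≡ multDiff ν γ) removals
  count≡multDiff = map⁺ (All.map (λ (L<i , ν↭p) → count-removal _ L<i ν↭p)
    (All.zip (all-filter (λ p → suc L ≤? proj₁ p) (picks ν) , filter⁺ _ (picks-↭ ν))))

numOBT-recurrence : ∀ β L ν → All (0 <_) β →
  numOBT ν (β ∷ʳ suc L) ≡ sumOver (S ν (suc L)) (λ γ → multDiff ν γ * numOBT γ β)
numOBT-recurrence β L ν pos = begin
  numOBT ν (β ∷ʳ suc L)
    ≡⟨ numOBT-∷ʳ ν β L ⟩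
  ∑ (removeBrick (suc L) ν) g
    ≡⟨ ∑-removeBrick-picks (suc L) ν (numOBT-↭ β pos) ⟩
  ∑ (picks ν) (λ p → 𝟙 (suc L ≤ᵇ proj₁ p) * g ((proj₁ p ∸ suc L) ∷ proj₂ p))
    ≡⟨ ∑-cong (picks ν) (λ p → cong (𝟙 (suc L ≤ᵇ proj₁ p) *_)
                                    (numOBT-replacePart β pos (suc L) (proj₁ p) (proj₂ p))) ⟩
  ∑ (picks ν) (λ p → 𝟙 (suc L ≤ᵇ proj₁ p) * g (removal p))
    ≡⟨ ∑-filter (λ p → suc L ≤? proj₁ p) (picks ν) (g ∘ removal) ⟨
  ∑ admissible (g ∘ removal)
    ≡⟨ ∑-map removal admissible g ⟨
  ∑ removals g
    ≡⟨ ∑-deduplicate _≟ᴸ_ removals g ⟩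
  ∑ (deduplicate _≟ᴸ_ removals) (λ γ → count _≟ᴸ_ γ removals * g γ)
    ≡⟨ ∑-cong-All (All.map (cong (_* _)) (deduplicate⁺ _≟ᴸ_ count≡multDiff)) ⟩
  sumOver (S ν (suc L)) (λ γ → multDiff ν γ * g γ) ∎
  where
  open ≡-Reasoning
  open Removal ν L
  g : List ℕ → ℕ
  g γ = numOBT γ β

lastPart-∷ʳ : ∀ xs x → lastPart (xs ∷ʳ x) ≡ x
lastPart-∷ʳ []           x = refl
lastPart-∷ʳ (y ∷ [])     x = refl
lastPart-∷ʳ (y ∷ z ∷ xs) x = lastPart-∷ʳ (z ∷ xs) x

initParts-∷ʳ : ∀ xs x → initParts (xs ∷ʳ x) ≡ xs
initParts-∷ʳ []           x = refl
initParts-∷ʳ (y ∷ [])     x = refl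
initParts-∷ʳ (y ∷ z ∷ xs) x = cong (y ∷_) (initParts-∷ʳ (z ∷ xs) x)

lemma6p7 : (n : ℕ) → n ≥ 1 → (λ' β : List ℕ) → IsPartition n λ' → IsComposition n β →
    numOBT λ' β ≡ sumOver (S λ' (lastPart β)) (λ γ → multDiff λ' γ * numOBT γ (initParts β))
lemma6p7 n n≥1 λ' β _ (pos , sum≡n) with reverseView β
... | []              = ⊥-elim (<⇒≢ n≥1 sum≡n)
... | β′ ∶ _ ∶ʳ zero  with () ← proj₂ (∷ʳ⁻ pos)
... | β′ ∶ _ ∶ʳ suc L rewrite lastPart-∷ʳ β′ (suc L) | initParts-∷ʳ β′ (suc L) =
  numOBT-recurrence β′ L λ' (proj₁ (∷ʳ⁻ pos))
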